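{- For each $k\ge 1$ there is a deterministic bottom-up tree automaton $\mathcal{A}^{k\text{ - }\mathsf{stw}}_{\mathsf{acyclic}}$ with $2^{\mathcal{O}(k^2)}$ states whose accepted language is the set of binary trees $\tau$ over $\Lambda^k$ such that $\tau$ is a valid $k$-STT and the graph $G_\tau$ is acyclic (the union of its edge relations has no directed cycle).
   Context: Fix an architecture with finite set of processes $\mathsf{Procs}$ and finite set of data structures $\mathsf{DS}$, and a finite alphabet $\Sigma$. Graphs have vertices labeled in $\Sigma\times\mathsf{Procs}$ and edges labeled in $\Gamma=\{\to\}\cup\mathsf{DS}$. For $[k]=\{1,\dots,k\}$, $k$-STTs are terms $\tau::=(i,a,p)\mid\mathsf{Add}^\gamma_{i,j}\tau\mid\mathsf{Forget}_i\tau\mid\tau\oplus\tau$ ($i,j\in[k]$, $a\in\Sigma$, $p\in\mathsf{Procs}$, $\gamma\in\Gamma$), denoting $[\![\tau]\!]=(G_\tau,\chi_\tau)$ with $\chi_\tau$ a partial injective map from $[k]$ to vertices: $(i,a,p)$ is a single vertex labeled $(a,p)$ with color $i$; $\mathsf{Add}^\gamma_{i,j}$ adds a $\gamma$-edge $(\chi(i),\chi(j))$ if $i,j\in\mathrm{dom}(\chi)$ (otherwise nothing); $\mathsf{Forget}_i$ removes $i$ from $\mathrm{dom}(\chi)$; $\oplus$ is disjoint union, defined only if the color domains are disjoint. A $k$-STT is valid if all its $\oplus$ are defined. Terms are viewed as ordered trees over the alphabet $\Lambda^k$ of these symbols (leaves $(i,a,p)$, unary nodes $\mathsf{Add}$/$\mathsf{Forget}$,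 binary nodes $\oplus$). -}

module Defs where

open import Data.Nat using (ℕ; zero; suc; _+_)
open import Data.Fin using (Fin; zero; suc; _≟_; splitAt; _↑ˡ_; _↑ʳ_)
open import Data.Maybe using (Maybe; just; nothing; map)
open import Data.Bool using (Bool; true)
open import Data.Sum using (_⊎_; inj₁; inj₂)
open import Data.Product using (_×_; Σ; ∃)
open import Data.Unit using (⊤)
open import Data.Empty using (⊥)
open import Relation.Nullary using (¬_; yes; no)
open import Relation.Binary.PropositionalEquality using (_≡_)

-- Architecture: Σ = Fin s (letters), Procs = Fin p, DS = Fin d.
-- Edge labels Γ = {→} ∪ DS.
data Γ (d : ℕ) : Set where
  succ : Γ d
  ds   : Fin d → Γ d

-- Binary trees over the ranked alphabet Λ^k (colors [k] = Fin k).
-- Every such tree is a (possibly invalid) k-STT term.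
data STT (k s p d : ℕ) : Set where
  leaf   : Fin k → Fin s → Fin p → STT k s p d
  add    : Γ d → Fin k → Fin k → STT k s p d → STT k s p d
  forget : Fin k → STT k s p d → STT k s p d
  _⊕_    : STT k s p d → STT k s p d → STT k s p d

module _ {k s p d : ℕ} where

  -- number of vertices of G_τ (vertices are Fin (nV τ))
  nV : STT k s p d → ℕ
  nV (leaf _ _ _)  = 1
  nV (add _ _ _ t) = nV t
  nV (forget _ t)  = nV t
  nV (t ⊕ u)       = nV t + nV u

  label : (t : STT k s p d) → Fin (nV t) → Fin s × Fin p
  label (leaf _ a q) _   = a Data.Product., q
  label (add _ _ _ t) v  = label t v
  label (forget _ t) v   = label t v
  label (t ⊕ u) v with splitAt (nV t) v
  ... | inj₁ x = label t x
  ... | inj₂ y = label u y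

  χ : (t : STT k s p d) → Fin k → Maybe (Fin (nV t))
  χ (leaf i _ _) j with j ≟ i
  ... | yes _ = just zero
  ... | no  _ = nothing
  χ (add _ _ _ t) j = χ t j
  χ (forget i t) j with j ≟ i
  ... | yes _ = nothing
  ... | no  _ = χ t j
  χ (t ⊕ u) j with χ t j
  ... | just v  = just (v ↑ˡ nV u)
  ... | nothing = map (nV t ↑ʳ_) (χ u j)

  Edge : (t : STT k s p d) → Γ d → Fin (nV t) → Fin (nV t) → Set
  Edge (leaf _ _ _) γ u v = ⊥
  Edge (add γ' i j t) γ u v =
    Edge t γ u v ⊎ (γ ≡ γ' × χ t i ≡ just u × χ t j ≡ just v)
  Edge (forget _ t) γ u v = Edge t γ u v
  Edge (t ⊕ w) γ u v with splitAt (nV t) u | splitAt (nV t) v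
  ... | inj₁ x | inj₁ y = Edge t γ x y
  ... | inj₂ x | inj₂ y = Edge w γ x y
  ... | inj₁ _ | inj₂ _ = ⊥
  ... | inj₂ _ | inj₁ _ = ⊥

  Valid : STT k s p d → Set
  Valid (leaf _ _ _)  = ⊤
  Valid (add _ _ _ t) = Valid t
  Valid (forget _ t)  = Valid t
  Valid (t ⊕ u) = Valid t × Valid u × (∀ j → χ t j ≡ nothing ⊎ χ u j ≡ nothing)

  AnyEdge : (t : STT k s p d) → Fin (nV t) → Fin (nV t) → Set
  AnyEdge t u v = Σ (Γ d) λ γ → Edge t γ u v

data Path {n : ℕ} (E : Fin n → Fin n → Set) : Fin n → Fin n → Set where
  [_]  : ∀ {u v} → E u v → Path E u v
  _∷_  : ∀ {u v w} → E u v → Path E v w → Path E u w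

Acyclic : ∀ {k s p d} → STT k s p d → Set
Acyclic t = ∀ v → ¬ Path (AnyEdge t) v v

record DBTA (k s p d : ℕ) : Set where
  field
    states  : ℕ
    δleaf   : Fin k → Fin s → Fin p → Fin states
    δadd    : Γ d → Fin k → Fin k → Fin states → Fin states
    δforget : Fin k → Fin states → Fin states
    δplus   : Fin states → Fin states → Fin states
    final   : Fin states → Bool

  run : STT k s p d → Fin states
  run (leaf i a q)    = δleaf i a q
  run (add γ i j t)   = δadd γ i j (run t)
  run (forget i t)    = δforget i (run t)
  run (t ⊕ u)         = δplus (run t) (run u)

  Accepts : STT k s p d → Set
  Accepts t = final (run t) ≡ true

-- The state after reading a term t is a summary of t: one bit saying that
-- t is valid and G_t acyclic, k bits describing dom χ_t, and k·k bits
-- saying which pairs of coloured vertices are joined by a nonempty path.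
-- Add and ⊕ only touch coloured vertices, so the summary of a term is a
-- function of the summaries of its immediate subterms.

module Submission where

open import Defs
open import Data.Nat using (ℕ; _≤_; _*_; _^_)
open import Data.Product using (Σ; _×_)
open import Function.Bundles using (_⇔_)

open import Data.Nat using (_+_; >-nonZero)
open import Data.Nat.Properties
  using ( ≤-refl; ≤-trans; +-mono-≤; +-assoc; +-identityʳ; m≤m*n; ^-monoʳ-≤
        ; module ≤-Reasoning)
open import Data.Fin
  using (Fin; zero; suc; _≟_; splitAt; _↑ˡ_; _↑ʳ_; combine; remQuot; funToFin; finToFun)
open import Data.Fin.Properties
  using (splitAt-↑ˡ; splitAt-↑ʳ; remQuot-combine; finToFun-funToFin; 2↔Bool; all?)
open import Data.Bool using (Bool; true; false; T; not; _∧_; _∨_; if_then_else_)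
open import Data.Bool.Properties using (T-∧; T-∨; T-≡)
open import Data.Maybe using (Maybe; just; nothing)
open import Data.Maybe.Properties using (just-injective)
open import Data.Sum using (_⊎_; inj₁; inj₂)
open import Data.Sum.Properties using (inj₁-injective; inj₂-injective)
open import Data.Product using (_,_; uncurry)
open import Data.Sum.Function.Propositional using (_⊎-⇔_)
open import Data.Product.Function.NonDependent.Propositional using (_×-⇔_)
open import Data.Unit using (tt)
open import Data.Empty using (⊥-elim)
open import Function.Base using (_∘_)
open import Function.Bundles using (Equivalence; Inverse; mk⇔)
open import Function.Properties.Equivalence
  using () renaming (refl to ⇔-refl; trans to ⇔-trans; sym to ⇔-sym)
open import Function.Related.TypeIsomorphisms using (¬-cong-⇔)
open import Relation.Nullary using (¬_; Dec; yes; no; does)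
open import Relation.Nullary.Decidable using (T?)
open import Relation.Binary.PropositionalEquality using (_≡_; refl; sym; trans; cong; subst; subst₂)

open Equivalence using (to; from)

private
  variable
    k s p d n : ℕ
    A B : Set

T-not : ∀ {b} → T (not b) ⇔ (¬ T b)
T-not {true}  = mk⇔ (λ ()) (λ ¬⊤ → ¬⊤ tt)
T-not {false} = mk⇔ (λ _ ()) (λ _ → tt)

T-does : ∀ {P : Set} (P? : Dec P) → T (does P?) ⇔ P
T-does (yes p) = mk⇔ (λ _ → p) (λ _ → tt)
T-does (no ¬p) = mk⇔ (λ ()) ¬p

Defined : Maybe A → Set
Defined {A} m = Σ A λ v → m ≡ just v

unique : ∀ {m : Maybe A} {u v} → m ≡ just u → m ≡ just v → u ≡ v
unique e e′ = just-injective (trans (sym e) e′)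

not-both-defined : {m : Maybe A} {m′ : Maybe B} →
                   (¬ (Defined m × Defined m′)) ⇔ (m ≡ nothing ⊎ m′ ≡ nothing)
not-both-defined {m = m} {m′} = mk⇔ (witness m m′) refute
  where
  witness : ∀ (m : Maybe A) (m′ : Maybe B) → ¬ (Defined m × Defined m′) →
            m ≡ nothing ⊎ m′ ≡ nothing
  witness nothing  _        _     = inj₁ refl
  witness (just _) nothing  _     = inj₂ refl
  witness (just u) (just v) ¬both = ⊥-elim (¬both ((u , refl) , (v , refl)))
  refute : m ≡ nothing ⊎ m′ ≡ nothing → ¬ (Defined m × Defined m′)
  refute (inj₁ refl) ((_ , ()) , _)
  refute (inj₂ refl) (_ , (_ , ()))

-- Paths in an arbitrary edge relation on Fin n

Rel : ℕ → Set₁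
Rel n = Fin n → Fin n → Set

Star : Rel n → Rel n
Star E u v = u ≡ v ⊎ Path E u v

NoCycle : Rel n → Set
NoCycle E = ∀ v → ¬ Path E v v

module _ {E : Rel n} where

  _++_ : ∀ {u v w} → Path E u v → Path E v w → Path E u w
  [ e ]   ++ π = e ∷ π
  (e ∷ π) ++ ρ = e ∷ (π ++ ρ)

  _◅_ : ∀ {u v w} → E u v → Star E v w → Path E u w
  e ◅ inj₁ refl = [ e ]
  e ◅ inj₂ π    = e ∷ π

  through : ∀ {a u v b} → Star E a u → E u v → Star E v b → Path E a b
  through (inj₁ refl) e ω = e ◅ ω
  through (inj₂ π)    e ω = π ++ (e ◅ ω)

  star-trans : ∀ {a b c} → Star E a b → Star E b c → Star E a c
  star-trans (inj₁ refl) ω = ω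
  star-trans (inj₂ π) (inj₁ refl) = inj₂ π
  star-trans (inj₂ π) (inj₂ ρ)    = inj₂ (π ++ ρ)

module _ {m : ℕ} {E : Rel n} {E′ : Rel m} {f : Fin n → Fin m}
         (hom : ∀ {u v} → E u v → E′ (f u) (f v)) where

  mapPath : ∀ {u v} → Path E u v → Path E′ (f u) (f v)
  mapPath [ e ]   = [ hom e ]
  mapPath (e ∷ π) = hom e ∷ mapPath π

  mapStar : ∀ {u v} → Star E u v → Star E′ (f u) (f v)
  mapStar (inj₁ u≡v) = inj₁ (cong f u≡v)
  mapStar (inj₂ π)   = inj₂ (mapPath π)

path-cong : {E E′ : Rel n} → (∀ {u v} → E u v ⇔ E′ u v) →
            ∀ {u v} → Path E u v ⇔ Path E′ u v
path-cong E⇔E′ = mk⇔ (mapPath (to E⇔E′)) (mapPath (from E⇔E′))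

noCycle-cong : {E E′ : Rel n} → (∀ {u v} → E u v ⇔ E′ u v) → NoCycle E ⇔ NoCycle E′
noCycle-cong E⇔E′ = mk⇔ (λ acyc v π → acyc v (from (path-cong E⇔E′) π))
                         (λ acyc v π → acyc v (to (path-cong E⇔E′) π))

-- Adding a single edge x → y to E: a path uses either no new edge, or it
-- reaches x, jumps to y, and continues; a cycle appears iff y ⇝ x in E.
module WithEdge {E E′ : Rel n} {x y : Fin n}
                (edges : ∀ {u v} → E′ u v ⇔ (E u v ⊎ (u ≡ x × v ≡ y))) where

  old : ∀ {u v} → E u v → E′ u v
  old e = from edges (inj₁ e)

  new : E′ x y
  new = from edges (inj₂ (refl , refl))

  split : ∀ {a b} → Path E′ a b → Path E a b ⊎ (Star E a x × Star E y b)
  split [ e ] with to edges e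
  ... | inj₁ e₀            = inj₁ [ e₀ ]
  ... | inj₂ (refl , refl) = inj₂ (inj₁ refl , inj₁ refl)
  split (e ∷ π) with to edges e | split π
  ... | inj₁ e₀            | inj₁ π₀        = inj₁ (e₀ ∷ π₀)
  ... | inj₁ e₀            | inj₂ (ω , ω′)  = inj₂ (inj₂ (e₀ ◅ ω) , ω′)
  ... | inj₂ (refl , refl) | inj₁ π₀        = inj₂ (inj₁ refl , inj₂ π₀)
  ... | inj₂ (refl , refl) | inj₂ (_ , ω′)  = inj₂ (inj₁ refl , ω′)

  join : ∀ {a b} → Path E a b ⊎ (Star E a x × Star E y b) → Path E′ a b
  join (inj₁ π)        = mapPath old π
  join (inj₂ (ω , ω′)) = through (mapStar old ω) new (mapStar old ω′)

  noCycle : NoCycle E′ ⇔ (NoCycle E × ¬ Star E y x)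
  noCycle = mk⇔ restrict unfold
    where
    restrict : NoCycle E′ → NoCycle E × ¬ Star E y x
    restrict acyc = (λ v π → acyc v (join (inj₁ π))) , (λ ω → acyc x (join (inj₂ (inj₁ refl , ω))))
    unfold : NoCycle E × ¬ Star E y x → NoCycle E′
    unfold (acyc , ¬y⇝x) v π with split π
    ... | inj₁ π₀       = acyc v π₀
    ... | inj₂ (ω , ω′) = ¬y⇝x (star-trans ω′ ω)

-- Colours and connections in the graph of a term

module _ {k s p d : ℕ} where

  Coloured : STT k s p d → Fin k → Set
  Coloured t a = Defined (χ t a)

  Between : (t : STT k s p d) → Rel (nV t) → Fin k → Fin k → Set
  Between t R a b = Σ _ λ u → Σ _ λ v → χ t a ≡ just u × χ t b ≡ just v × R u v

  between-cong : ∀ t {R R′} → (∀ {u v} → R u v ⇔ R′ u v) →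
                 ∀ {a b} → Between t R a b ⇔ Between t R′ a b
  between-cong t R⇔R′ = mk⇔ (λ (u , v , ea , eb , r) → u , v , ea , eb , to R⇔R′ r)
                           (λ (u , v , ea , eb , r) → u , v , ea , eb , from R⇔R′ r)

  Reach Reach* : STT k s p d → Fin k → Fin k → Set
  Reach  t = Between t (Path (AnyEdge t))
  Reach* t = Between t (Star (AnyEdge t))

  -- The colouring of t ⊕ w: the first nV t vertices are those of t, the
  -- others those of w, and a colour of t takes precedence over one of w.
  module _ (t w : STT k s p d) where

    χ-⊕ˡ : ∀ {a u} → χ t a ≡ just u → χ (t ⊕ w) a ≡ just (u ↑ˡ nV w)
    χ-⊕ˡ e rewrite e = refl

    χ-⊕ʳ : ∀ {a v} → χ t a ≡ nothing → χ w a ≡ just v → χ (t ⊕ w) a ≡ just (nV t ↑ʳ v)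
    χ-⊕ʳ e e′ rewrite e | e′ = refl

    colourˡ : ∀ {a z x} → χ (t ⊕ w) a ≡ just z → splitAt (nV t) z ≡ inj₁ x → χ t a ≡ just x
    colourˡ {a} e side with χ t a
    colourˡ refl side | just u =
      cong just (inj₁-injective (trans (sym (splitAt-↑ˡ (nV t) u (nV w))) side))
    colourˡ {a} e side | nothing with χ w a
    colourˡ refl side | nothing | just v with trans (sym (splitAt-↑ʳ (nV t) (nV w) v)) side
    ... | ()

    colourʳ : ∀ {a z y} → χ (t ⊕ w) a ≡ just z → splitAt (nV t) z ≡ inj₂ y → χ w a ≡ just y
    colourʳ {a} e side with χ t a
    colourʳ refl side | just u with trans (sym (splitAt-↑ˡ (nV t) u (nV w))) side
    ... | ()
    colourʳ {a} e side | nothing with χ w a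
    colourʳ refl side | nothing | just v =
      cong just (inj₂-injective (trans (sym (splitAt-↑ʳ (nV t) (nV w) v)) side))

    coloured-⊕ : ∀ {a} → Coloured (t ⊕ w) a ⇔ (Coloured t a ⊎ Coloured w a)
    coloured-⊕ {a} = mk⇔ side sideᵒ
      where
      side : Coloured (t ⊕ w) a → Coloured t a ⊎ Coloured w a
      side (z , e) with splitAt (nV t) z in eq
      ... | inj₁ x = inj₁ (x , colourˡ e eq)
      ... | inj₂ y = inj₂ (y , colourʳ e eq)
      sideᵒ : Coloured t a ⊎ Coloured w a → Coloured (t ⊕ w) a
      sideᵒ (inj₁ (_ , e)) = _ , χ-⊕ˡ e
      sideᵒ (inj₂ (_ , e)) = leftFirst (χ t a) refl e
        where
        leftFirst : ∀ {v} m → χ t a ≡ m → χ w a ≡ just v → Coloured (t ⊕ w) a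
        leftFirst (just _) eq _ = _ , χ-⊕ˡ eq
        leftFirst nothing  eq e = _ , χ-⊕ʳ eq e

  -- χ_t is injective; the automaton identifies coloured vertices by their colour
  χ-injective : (t : STT k s p d) → ∀ {a b v} → χ t a ≡ just v → χ t b ≡ just v → a ≡ b
  χ-injective (leaf i _ _) {a} {b} ea eb with a ≟ i | b ≟ i
  ... | yes a≡i | yes b≡i = trans a≡i (sym b≡i)
  χ-injective (leaf i _ _) () eb | no _ | _
  χ-injective (leaf i _ _) ea () | yes _ | no _
  χ-injective (add _ _ _ t) ea eb = χ-injective t ea eb
  χ-injective (forget i t) {a} {b} ea eb with a ≟ i | b ≟ i
  ... | no _ | no _ = χ-injective t ea eb
  χ-injective (forget i t) () eb | yes _ | _
  χ-injective (forget i t) ea () | no _ | yes _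
  χ-injective (t ⊕ w) {v = z} ea eb with splitAt (nV t) z in side
  ... | inj₁ x = χ-injective t (colourˡ t w ea side) (colourˡ t w eb side)
  ... | inj₂ y = χ-injective w (colourʳ t w ea side) (colourʳ t w eb side)

  -- G_{t ⊕ w} is the disjoint union of G_t and G_w: edges and paths never
  -- cross between the two blocks, and paths of either part lift.
  module _ (t w : STT k s p d) where

    edgeˡ : ∀ {γ u v x} → splitAt (nV t) u ≡ inj₁ x → Edge (t ⊕ w) γ u v →
            Σ _ λ y → splitAt (nV t) v ≡ inj₁ y × Edge t γ x y
    edgeˡ {γ} {u} {v} side e with splitAt (nV t) u | splitAt (nV t) v
    edgeˡ refl e | inj₁ x | inj₁ y = y , refl , e

    edgeʳ : ∀ {γ u v x} → splitAt (nV t) u ≡ inj₂ x → Edge (t ⊕ w) γ u v →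
            Σ _ λ y → splitAt (nV t) v ≡ inj₂ y × Edge w γ x y
    edgeʳ {γ} {u} {v} side e with splitAt (nV t) u | splitAt (nV t) v
    edgeʳ refl e | inj₂ x | inj₂ y = y , refl , e

    pathˡ : ∀ {u v x} → Path (AnyEdge (t ⊕ w)) u v → splitAt (nV t) u ≡ inj₁ x →
            Σ _ λ y → splitAt (nV t) v ≡ inj₁ y × Path (AnyEdge t) x y
    pathˡ [ γ , e ] side with edgeˡ side e
    ... | y , side′ , e′ = y , side′ , [ γ , e′ ]
    pathˡ ((γ , e) ∷ π) side with edgeˡ side e
    ... | y , side′ , e′ with pathˡ π side′
    ...   | z , side″ , π′ = z , side″ , (γ , e′) ∷ π′

    pathʳ : ∀ {u v x} → Path (AnyEdge (t ⊕ w)) u v → splitAt (nV t) u ≡ inj₂ x →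
            Σ _ λ y → splitAt (nV t) v ≡ inj₂ y × Path (AnyEdge w) x y
    pathʳ [ γ , e ] side with edgeʳ side e
    ... | y , side′ , e′ = y , side′ , [ γ , e′ ]
    pathʳ ((γ , e) ∷ π) side with edgeʳ side e
    ... | y , side′ , e′ with pathʳ π side′
    ...   | z , side″ , π′ = z , side″ , (γ , e′) ∷ π′

    liftˡ : ∀ {x y} → Path (AnyEdge t) x y → Path (AnyEdge (t ⊕ w)) (x ↑ˡ nV w) (y ↑ˡ nV w)
    liftˡ = mapPath λ { {x} {y} (γ , e) → γ , edge x y e }
      where
      edge : ∀ {γ} x y → Edge t γ x y → Edge (t ⊕ w) γ (x ↑ˡ nV w) (y ↑ˡ nV w)
      edge x y e rewrite splitAt-↑ˡ (nV t) x (nV w) | splitAt-↑ˡ (nV t) y (nV w) = e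

    liftʳ : ∀ {x y} → Path (AnyEdge w) x y → Path (AnyEdge (t ⊕ w)) (nV t ↑ʳ x) (nV t ↑ʳ y)
    liftʳ = mapPath λ { {x} {y} (γ , e) → γ , edge x y e }
      where
      edge : ∀ {γ} x y → Edge w γ x y → Edge (t ⊕ w) γ (nV t ↑ʳ x) (nV t ↑ʳ y)
      edge x y e rewrite splitAt-↑ʳ (nV t) (nV w) x | splitAt-↑ʳ (nV t) (nV w) y = e

    acyclic-⊕ : Acyclic (t ⊕ w) ⇔ (Acyclic t × Acyclic w)
    acyclic-⊕ = mk⇔ (λ acyc → (λ x π → acyc _ (liftˡ π)) , (λ y π → acyc _ (liftʳ π))) glue
      where
      glue : Acyclic t × Acyclic w → Acyclic (t ⊕ w)
      glue (acycˡ , acycʳ) z π with splitAt (nV t) z in side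
      ... | inj₁ x with pathˡ π side
      ...   | _ , side′ , π′ with inj₁-injective (trans (sym side) side′)
      ...     | refl = acycˡ x π′
      glue (acycˡ , acycʳ) z π | inj₂ y with pathʳ π side
      ...   | _ , side′ , π′ with inj₂-injective (trans (sym side) side′)
      ...     | refl = acycʳ y π′

    reach-⊕ : (∀ a → χ t a ≡ nothing ⊎ χ w a ≡ nothing) →
              ∀ {a b} → Reach (t ⊕ w) a b ⇔ (Reach t a b ⊎ Reach w a b)
    reach-⊕ disjoint = mk⇔ side sideᵒ
      where
      side : ∀ {a b} → Reach (t ⊕ w) a b → Reach t a b ⊎ Reach w a b
      side (z , _ , ea , eb , π) with splitAt (nV t) z in sa
      ... | inj₁ x with pathˡ π sa
      ...   | y , sb , π′ = inj₁ (x , y , colourˡ t w ea sa , colourˡ t w eb sb , π′)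
      side (z , _ , ea , eb , π) | inj₂ x with pathʳ π sa
      ...   | y , sb , π′ = inj₂ (x , y , colourʳ t w ea sa , colourʳ t w eb sb , π′)

      onlyRight : ∀ {a v} → χ w a ≡ just v → χ t a ≡ nothing
      onlyRight {a} e with disjoint a
      ... | inj₁ e′ = e′
      ... | inj₂ e′ with trans (sym e) e′
      ...   | ()

      sideᵒ : ∀ {a b} → Reach t a b ⊎ Reach w a b → Reach (t ⊕ w) a b
      sideᵒ (inj₁ (_ , _ , ea , eb , π)) = _ , _ , χ-⊕ˡ t w ea , χ-⊕ˡ t w eb , liftˡ π
      sideᵒ (inj₂ (_ , _ , ea , eb , π)) =
        _ , _ , χ-⊕ʳ t w (onlyRight ea) ea , χ-⊕ʳ t w (onlyRight eb) eb , liftʳ π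

-- Summaries: the finite information the automaton keeps about a term

record Summary (k : ℕ) : Set where
  constructor summary
  field
    ok    : Bool                   -- the term is valid and its graph acyclic
    dom   : Fin k → Bool           -- the colour is in dom χ
    reach : Fin k → Fin k → Bool   -- a nonempty path joins the two colours

  reach* : Fin k → Fin k → Bool
  reach* a b = (does (a ≟ b) ∧ dom a) ∨ reach a b

open Summary

-- σ describes t exactly.  Reachability is only required for valid terms:
-- an invalid ⊕ merges two colour domains and loses track of paths.
record Represents {k s p d : ℕ} (t : STT k s p d) (σ : Summary k) : Set where
  field
    ok-correct    : T (ok σ) ⇔ (Valid t × Acyclic t)
    dom-correct   : ∀ a → T (dom σ a) ⇔ Coloured t a
    reach-correct : Valid t → ∀ a b → T (reach σ a b) ⇔ Reach t a b

  -- the empty path is detected through injectivity of χ_t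
  reach*-correct : Valid t → ∀ a b → T (reach* σ a b) ⇔ Reach* t a b
  reach*-correct valid a b = ⇔-trans T-∨ (mk⇔ fwd bwd)
    where
    fwd : T (does (a ≟ b) ∧ dom σ a) ⊎ T (reach σ a b) → Reach* t a b
    fwd (inj₁ h) with a ≟ b | h
    ... | yes refl | h′ = let (u , e) = to (dom-correct a) h′ in u , u , e , e , inj₁ refl
    fwd (inj₂ r) =
      let (u , v , ea , eb , π) = to (reach-correct valid a b) r in u , v , ea , eb , inj₂ π
    bwd : Reach* t a b → T (does (a ≟ b) ∧ dom σ a) ⊎ T (reach σ a b)
    bwd (u , _ , ea , eb , inj₁ refl) with χ-injective t ea eb
    ... | refl with a ≟ a
    ...   | yes _  = inj₁ (from (dom-correct a) (u , ea))
    ...   | no a≢a = ⊥-elim (a≢a refl)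
    bwd (u , v , ea , eb , inj₂ π) =
      inj₂ (from (reach-correct valid a b) (u , v , ea , eb , π))

open Represents

leafS : Fin k → Summary k
leafS i = summary true (λ a → does (a ≟ i)) (λ _ _ → false)

represents-leaf : ∀ (i : Fin k) (a : Fin s) (q : Fin p) →
                  Represents {d = d} (leaf i a q) (leafS i)
represents-leaf {d = d} i a q = record
  { ok-correct    = mk⇔ (λ _ → tt , λ _ → noPath) (λ _ → tt)
  ; dom-correct   = domain
  ; reach-correct = λ _ _ _ → mk⇔ (λ ()) (λ (_ , _ , _ , _ , π) → noPath π)
  }
  where
  noPath : ∀ {u v} → ¬ Path (AnyEdge (leaf {d = d} i a q)) u v
  noPath [ _ , () ]
  noPath ((_ , ()) ∷ _)
  domain : ∀ b → T (does (b ≟ i)) ⇔ Coloured (leaf {d = d} i a q) b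
  domain b with b ≟ i
  ... | yes _ = mk⇔ (λ _ → zero , refl) (λ _ → tt)
  ... | no _  = mk⇔ (λ ()) (λ ())

survives : Fin k → Fin k → Bool
survives i a = not (does (a ≟ i))

forgetS : Fin k → Summary k → Summary k
forgetS i σ = summary (ok σ) (λ a → survives i a ∧ dom σ a)
                              (λ a b → survives i a ∧ (survives i b ∧ reach σ a b))

represents-forget : ∀ {t : STT k s p d} {σ} i → Represents t σ →
                    Represents (forget i t) (forgetS i σ)
represents-forget {t = t} {σ} i R = record
  { ok-correct    = ok-correct R
  ; dom-correct   = domain
  ; reach-correct = reach′
  }
  where
  domain : ∀ a → T (survives i a ∧ dom σ a) ⇔ Coloured (forget i t) a
  domain a with a ≟ i
  ... | yes _ = mk⇔ (λ ()) (λ ())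
  ... | no _  = dom-correct R a
  reach′ : Valid t → ∀ a b →
           T (survives i a ∧ (survives i b ∧ reach σ a b)) ⇔ Reach (forget i t) a b
  reach′ valid a b with a ≟ i | b ≟ i
  ... | yes _ | _     = mk⇔ (λ ()) (λ ())
  ... | no _  | yes _ = mk⇔ (λ ()) (λ ())
  ... | no _  | no _  = reach-correct R valid a b

-- Add^γ_{i,j} adds the edge χ(i) → χ(j) when both colours are present and
-- is ignored otherwise.  The new
-- edge closes a cycle iff j already reaches i, and a joins b afterwards iff
-- it did before or a reaches i and j reaches b.
linkS : Fin k → Fin k → Summary k → Summary k
linkS i j σ = summary (ok σ ∧ not (reach* σ j i)) (dom σ)
                      (λ a b → reach σ a b ∨ (reach* σ a i ∧ reach* σ j b))

addS : Fin k → Fin k → Summary k → Summary k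
addS i j σ = if dom σ i ∧ dom σ j then linkS i j σ else σ

represents-idle : ∀ {t : STT k s p d} {σ i j} γ → Represents t σ →
                  ¬ (Coloured t i × Coloured t j) → Represents (add γ i j t) σ
represents-idle {t = t} {σ} {i} {j} γ R idle = record
  { ok-correct    = ⇔-trans (ok-correct R) (⇔-refl ×-⇔ noCycle-cong (⇔-sym sameEdges))
  ; dom-correct   = dom-correct R
  ; reach-correct = λ valid a b →
      ⇔-trans (reach-correct R valid a b) (between-cong t (path-cong (⇔-sym sameEdges)))
  }
  where
  sameEdges : ∀ {u v} → AnyEdge (add γ i j t) u v ⇔ AnyEdge t u v
  sameEdges = mk⇔ (λ { (γ′ , inj₁ e) → γ′ , e
                     ; (_ , inj₂ (_ , ei , ej)) → ⊥-elim (idle ((_ , ei) , (_ , ej))) })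
                  (λ (γ′ , e) → γ′ , inj₁ e)

represents-link : ∀ {t : STT k s p d} {σ i j x y} γ → Represents t σ →
                  χ t i ≡ just x → χ t j ≡ just y → Represents (add γ i j t) (linkS i j σ)
represents-link {t = t} {σ} {i} {j} {x} {y} γ R ex ey = record
  { ok-correct    = okay
  ; dom-correct   = dom-correct R
  ; reach-correct = reachable
  }
  where
  newEdge : ∀ {u v} → AnyEdge (add γ i j t) u v ⇔ (AnyEdge t u v ⊎ (u ≡ x × v ≡ y))
  newEdge = mk⇔ (λ { (γ′ , inj₁ e) → inj₁ (γ′ , e)
                   ; (_ , inj₂ (_ , ei , ej)) → inj₂ (unique ei ex , unique ej ey) })
                (λ { (inj₁ (γ′ , e)) → γ′ , inj₁ e
                   ; (inj₂ (refl , refl)) → γ , inj₂ (refl , ex , ey) })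

  module W = WithEdge newEdge

  closes : Valid t → T (reach* σ j i) ⇔ Star (AnyEdge t) y x
  closes valid = ⇔-trans (reach*-correct R valid j i)
    (mk⇔ (λ (_ , _ , ey′ , ex′ , ω) → subst₂ (Star (AnyEdge t)) (unique ey′ ey) (unique ex′ ex) ω)
         (λ ω → y , x , ey , ex , ω))

  okay : T (ok σ ∧ not (reach* σ j i)) ⇔ (Valid t × Acyclic (add γ i j t))
  okay = ⇔-trans T-∧ (mk⇔ fwd bwd)
    where
    fwd : T (ok σ) × T (not (reach* σ j i)) → Valid t × Acyclic (add γ i j t)
    fwd (good , fresh) = let (valid , acyc) = to (ok-correct R) good in
      valid , from W.noCycle (acyc , λ ω → to T-not fresh (from (closes valid) ω))
    bwd : Valid t × Acyclic (add γ i j t) → T (ok σ) × T (not (reach* σ j i))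
    bwd (valid , acyc′) = let (acyc , fresh) = to W.noCycle acyc′ in
      from (ok-correct R) (valid , acyc) , from T-not (fresh ∘ to (closes valid))

  reachable : Valid t → ∀ a b →
              T (reach σ a b ∨ (reach* σ a i ∧ reach* σ j b)) ⇔ Reach (add γ i j t) a b
  reachable valid a b = ⇔-trans T-∨ (⇔-trans
    (reach-correct R valid a b
      ⊎-⇔ ⇔-trans T-∧ (reach*-correct R valid a i ×-⇔ reach*-correct R valid j b))
    (mk⇔ fwd bwd))
    where
    fwd : Reach t a b ⊎ (Reach* t a i × Reach* t j b) → Reach (add γ i j t) a b
    fwd (inj₁ (u , v , ea , eb , π)) = u , v , ea , eb , W.join (inj₁ π)
    fwd (inj₂ ((u , x′ , ea , ex′ , w₁) , (y′ , v , ey′ , eb , w₂)))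
      with unique ex′ ex | unique ey′ ey
    ... | refl | refl = u , v , ea , eb , W.join (inj₂ (w₁ , w₂))
    bwd : Reach (add γ i j t) a b → Reach t a b ⊎ (Reach* t a i × Reach* t j b)
    bwd (u , v , ea , eb , π) with W.split π
    ... | inj₁ π₀       = inj₁ (u , v , ea , eb , π₀)
    ... | inj₂ (w₁ , w₂) = inj₂ ((u , x , ea , ex , w₁) , (y , v , ey , eb , w₂))

represents-add : ∀ {t : STT k s p d} {σ} γ i j → Represents t σ →
                 Represents (add γ i j t) (addS i j σ)
represents-add {σ = σ} γ i j R with dom σ i ∧ dom σ j in both
... | true  = let (di , dj) = to T-∧ (from T-≡ both)
                  (_ , ex)  = to (dom-correct R i) di
                  (_ , ey)  = to (dom-correct R j) dj
              in represents-link γ R ex ey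
... | false = represents-idle γ R λ (ci , cj) →
                subst T both (from T-∧ (from (dom-correct R i) ci , from (dom-correct R j) cj))

disjoint : Summary k → Summary k → Bool
disjoint σ τ = does (all? λ a → T? (not (dom σ a ∧ dom τ a)))

plusS : Summary k → Summary k → Summary k
plusS σ τ = summary (ok σ ∧ (ok τ ∧ disjoint σ τ)) (λ a → dom σ a ∨ dom τ a)
                    (λ a b → reach σ a b ∨ reach τ a b)

represents-plus : ∀ {t w : STT k s p d} {σ τ} → Represents t σ → Represents w τ →
                  Represents (t ⊕ w) (plusS σ τ)
represents-plus {t = t} {w} {σ} {τ} R S = record
  { ok-correct    = ⇔-trans T-∧ (⇔-trans
      (ok-correct R ×-⇔ ⇔-trans T-∧ (ok-correct S ×-⇔ separated)) (mk⇔ fwd bwd))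
  ; dom-correct   = λ a →
      ⇔-trans T-∨ (⇔-trans (dom-correct R a ⊎-⇔ dom-correct S a) (⇔-sym (coloured-⊕ t w)))
  ; reach-correct = λ (valid-t , valid-w , apart) a b →
      ⇔-trans T-∨ (⇔-trans (reach-correct R valid-t a b ⊎-⇔ reach-correct S valid-w a b)
                           (⇔-sym (reach-⊕ t w apart)))
  }
  where
  Disjoint : Set
  Disjoint = ∀ a → χ t a ≡ nothing ⊎ χ w a ≡ nothing

  apart : ∀ a → T (not (dom σ a ∧ dom τ a)) ⇔ (χ t a ≡ nothing ⊎ χ w a ≡ nothing)
  apart a = ⇔-trans T-not
    (⇔-trans (¬-cong-⇔ (⇔-trans T-∧ (dom-correct R a ×-⇔ dom-correct S a))) not-both-defined)

  separated : T (disjoint σ τ) ⇔ Disjoint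
  separated = ⇔-trans (T-does (all? _))
                      (mk⇔ (λ h a → to (apart a) (h a)) (λ h a → from (apart a) (h a)))

  fwd : (Valid t × Acyclic t) × (Valid w × Acyclic w) × Disjoint →
        Valid (t ⊕ w) × Acyclic (t ⊕ w)
  fwd ((valid-t , acyc-t) , (valid-w , acyc-w) , disj) =
    (valid-t , valid-w , disj) , from (acyclic-⊕ t w) (acyc-t , acyc-w)

  bwd : Valid (t ⊕ w) × Acyclic (t ⊕ w) →
        (Valid t × Acyclic t) × (Valid w × Acyclic w) × Disjoint
  bwd ((valid-t , valid-w , disj) , acyc) =
    let (acyc-t , acyc-w) = to (acyclic-⊕ t w) acyc
    in (valid-t , acyc-t) , (valid-w , acyc-w) , disj

-- Summaries as bit strings: one bit for ok, k for dom and k·k for reach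

width : ℕ → ℕ
width k = 1 + k + k * k

toBits : Summary k → Fin (width k) → Bool
toBits {k} σ c with splitAt (1 + k) c
... | inj₁ zero    = ok σ
... | inj₁ (suc a) = dom σ a
... | inj₂ ab      = uncurry (reach σ) (remQuot k ab)

fromBits : (Fin (width k) → Bool) → Summary k
fromBits {k} f =
  summary (f zero) (λ a → f (suc a ↑ˡ k * k)) (λ a b → f ((1 + k) ↑ʳ combine a b))

record _≈_ (σ τ : Summary k) : Set where
  field
    ok≡    : ok σ ≡ ok τ
    dom≡   : ∀ a → dom σ a ≡ dom τ a
    reach≡ : ∀ a b → reach σ a b ≡ reach τ a b

open _≈_

fromBits-toBits : ∀ {f} (σ : Summary k) → (∀ c → f c ≡ toBits σ c) → fromBits f ≈ σ
fromBits-toBits {k} σ f≗ = record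
  { ok≡    = f≗ zero
  ; dom≡   = λ a → trans (f≗ _) (domBit a)
  ; reach≡ = λ a b → trans (f≗ _) (reachBit a b)
  }
  where
  domBit : ∀ a → toBits σ (suc a ↑ˡ k * k) ≡ dom σ a
  domBit a rewrite splitAt-↑ˡ (1 + k) (suc a) (k * k) = refl
  reachBit : ∀ a b → toBits σ ((1 + k) ↑ʳ combine a b) ≡ reach σ a b
  reachBit a b rewrite splitAt-↑ʳ (1 + k) (k * k) (combine a b) =
    cong (uncurry (reach σ)) (remQuot-combine a b)

encode : Summary k → Fin (2 ^ width k)
encode σ = funToFin (Inverse.from 2↔Bool ∘ toBits σ)

decode : Fin (2 ^ width k) → Summary k
decode c = fromBits (Inverse.to 2↔Bool ∘ finToFun c)

decode-encode : (σ : Summary k) → decode (encode σ) ≈ σ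
decode-encode σ = fromBits-toBits σ λ c →
  trans (cong (Inverse.to 2↔Bool) (finToFun-funToFin (Inverse.from 2↔Bool ∘ toBits σ) c))
        (Inverse.strictlyInverseˡ 2↔Bool (toBits σ c))

represents-resp : ∀ {t : STT k s p d} {σ τ} → Represents t σ → τ ≈ σ → Represents t τ
represents-resp {t = t} R τ≈σ = record
  { ok-correct    = subst (λ b → T b ⇔ (Valid t × Acyclic t)) (sym (ok≡ τ≈σ)) (ok-correct R)
  ; dom-correct   = λ a → subst (λ b → T b ⇔ Coloured t a) (sym (dom≡ τ≈σ a)) (dom-correct R a)
  ; reach-correct = λ valid a b →
      subst (λ r → T r ⇔ Reach t a b) (sym (reach≡ τ≈σ a b)) (reach-correct R valid a b)
  }

width-bound : 1 ≤ k → width k ≤ 3 * (k * k)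
width-bound {k} 1≤k = begin
  1 + k + k * k           ≤⟨ +-mono-≤ (+-mono-≤ 1≤k*k k≤k*k) ≤-refl ⟩
  k * k + k * k + k * k   ≡⟨ +-assoc (k * k) (k * k) (k * k) ⟩
  k * k + (k * k + k * k) ≡⟨ cong (λ z → k * k + (k * k + z)) (sym (+-identityʳ (k * k))) ⟩
  3 * (k * k)             ∎
  where
  open ≤-Reasoning
  k≤k*k : k ≤ k * k
  k≤k*k = m≤m*n k k {{>-nonZero 1≤k}}
  1≤k*k : 1 ≤ k * k
  1≤k*k = ≤-trans 1≤k k≤k*k

summaryAutomaton : (k s p d : ℕ) → DBTA k s p d
summaryAutomaton k s p d = record
  { states  = 2 ^ width k
  ; δleaf   = λ i _ _ → encode (leafS i)
  ; δadd    = λ _ i j c → encode (addS i j (decode {k} c))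
  ; δforget = λ i c → encode (forgetS i (decode {k} c))
  ; δplus   = λ c c′ → encode (plusS (decode {k} c) (decode c′))
  ; final   = ok ∘ decode {k}
  }

module _ {k s p d : ℕ} where
  open DBTA (summaryAutomaton k s p d)

  summaryOf : STT k s p d → Summary k
  summaryOf t = decode {k} (run t)

  represents-run : (t : STT k s p d) → Represents t (summaryOf t)
  represents-run (leaf i a q) =
    represents-resp (represents-leaf i a q) (decode-encode (leafS i))
  represents-run (add γ i j t) =
    represents-resp (represents-add γ i j (represents-run t)) (decode-encode (addS i j (summaryOf t)))
  represents-run (forget i t) =
    represents-resp (represents-forget i (represents-run t)) (decode-encode (forgetS i (summaryOf t)))
  represents-run (t ⊕ w) =
    represents-resp (represents-plus (represents-run t) (represents-run w))
                    (decode-encode (plusS (summaryOf t) (summaryOf w)))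

  accepts⇔ : (t : STT k s p d) → Accepts t ⇔ (Valid t × Acyclic t)
  accepts⇔ t = ⇔-trans (⇔-sym T-≡) (ok-correct (represents-run t))

mainTheorem6 : (s p d : ℕ) → Σ ℕ λ c → (k : ℕ) → 1 ≤ k →
    Σ (DBTA k s p d) λ A →
      (DBTA.states A ≤ 2 ^ (c * (k * k)))
      × ((t : STT k s p d) → DBTA.Accepts A t ⇔ (Valid t × Acyclic t))
mainTheorem6 s p d = 3 , λ k 1≤k →
  summaryAutomaton k s p d , ^-monoʳ-≤ 2 (width-bound 1≤k) , accepts⇔
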